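{- Let $G$ be a planar cubic bipartite graph and $uv$ an edge of $G$, and let $G'$ be the planar cubic bipartite graph obtained from $G$ by replacing the edge $uv$ with the gadget described below (in which $x$ is a designated vertex). Then $G$ contains a Hamiltonian cycle through the edge $uv$ if and only if $G'$ contains a trail of length $|V(G')| + 1$ starting at $x$.
   Context: A trail is a walk with no repeated edge; its length is its number of edges. The gadget: delete the edge $uv$ and add four disjoint copies $A, B, C, D$ of the following 8-vertex graph $W$ with vertices $g_1,\dots,g_8$: $W$ has the 8-cycle $g_1g_2g_3g_4g_5g_8g_7g_6g_1$ together with the chords $g_2g_7$, $g_3g_8$, $g_5g_6$ (so $g_1, g_4$ have degree $2$ in $W$ and all other vertices degree $3$). Write $g_i^A$ etc. for the copies. Add two new vertices $x$ and $y$ and the edges $u g_1^A$, $g_4^A x$, $x g_1^B$, $x g_1^D$, $g_4^B y$, $g_4^D y$, $y g_1^C$, $g_4^C v$. The resulting graph $G'$ is planar, cubic and bipartite. -}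

module Defs where

open import Data.Bool using (Bool; true; false; T; _∧_; _∨_; not)
open import Data.Nat using (ℕ; zero; suc; _+_; _*_; _≡ᵇ_; _≥_)
open import Data.Fin using (Fin; _≟_)
open import Data.Product using (Σ; ∃; _×_; _,_)
open import Data.Sum using (_⊎_; inj₁; inj₂)
open import Data.List using (List; []; _∷_; _++_; length; map; allFin)
open import Data.Nat.ListAction using (sum)
open import Data.List.Relation.Unary.All using (All)
open import Data.List.Relation.Unary.AllPairs using (AllPairs)
open import Data.List.Relation.Unary.Unique.Propositional using (Unique)
open import Data.List.Relation.Unary.Any using (Any)
open import Data.List.Membership.Propositional using (_∈_)
open import Relation.Nullary using (¬_)
open import Relation.Nullary.Decidable using (⌊_⌋)
open import Relation.Binary.PropositionalEquality using (_≡_)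
open import Function.Bundles using (_⇔_)

record SimpleGraph (n : ℕ) : Set where
  field
    adj        : Fin n → Fin n → Bool
    adj-sym    : ∀ a b → adj a b ≡ adj b a
    adj-irrefl : ∀ a → adj a a ≡ false
open SimpleGraph public

Adj : {V : Set} → (V → V → Bool) → V → V → Set
Adj adj a b = T (adj a b)

countTrue : List Bool → ℕ
countTrue []          = 0
countTrue (true ∷ bs)  = suc (countTrue bs)
countTrue (false ∷ bs) = countTrue bs

degree : ∀ {n} → SimpleGraph n → Fin n → ℕ
degree G a = countTrue (map (adj G a) (allFin _))

Cubic : ∀ {n} → SimpleGraph n → Set
Cubic G = ∀ a → degree G a ≡ 3

Bipartite : ∀ {n} → SimpleGraph n → Set
Bipartite {n} G = Σ (Fin n → Bool) λ col → ∀ a b → Adj (adj G) a b → ¬ (col a ≡ col b)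

-- Planarity, via combinatorial embeddings (rotation systems) and
-- Euler's formula (Mohar–Thomassen, "Graphs on Surfaces", Ch. 3–4):
-- a graph is planar iff it has a rotation system whose Euler
-- characteristic equals 2 on every component, i.e.
--   n − m + (#faces) = 2·(#components),
-- where isolated vertices contribute one face each.

iter : {A : Set} → (A → A) → ℕ → A → A
iter f zero    x = x
iter f (suc k) x = f (iter f k x)

-- data (rot a) is the local rotation at a: the successor of neighbour b
-- in the cyclic order of the neighbours of a.
record RotationSystem {n : ℕ} (G : SimpleGraph n) : Set where
  field
    rot       : Fin n → Fin n → Fin n
    rot-nbr   : ∀ a b → Adj (adj G) a b → Adj (adj G) a (rot a b)
    rot-cycle : ∀ a b c → Adj (adj G) a b → Adj (adj G) a c →
                ∃ λ k → iter (rot a) k b ≡ c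
open RotationSystem public

Dart : ∀ {n} → SimpleGraph n → Set
Dart {n} G = Σ (Fin n × Fin n) λ { (a , b) → Adj (adj G) a b }

-- face-tracing permutation on ordered pairs
faceStep : ∀ {n} {G : SimpleGraph n} → RotationSystem G → Fin n × Fin n → Fin n × Fin n
faceStep ρ (a , b) = (b , rot ρ b a)

SameFace : ∀ {n} {G : SimpleGraph n} → RotationSystem G → Dart G → Dart G → Set
SameFace ρ (d , _) (e , _) = ∃ λ k → iter (faceStep ρ) k d ≡ e

data Reach {V : Set} (adj : V → V → Bool) : V → V → Set where
  here  : ∀ {a} → Reach adj a a
  step  : ∀ {a b c} → Adj adj a b → Reach adj b c → Reach adj a c

-- number of darts (= 2·|E|) and of isolated vertices
numDarts : ∀ {n} → SimpleGraph n → ℕ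
numDarts G = sum (map (degree G) (allFin _))

numIsolated : ∀ {n} → SimpleGraph n → ℕ
numIsolated G = countTrue (map (λ a → degree G a ≡ᵇ 0) (allFin _))

Planar : ∀ {n} → SimpleGraph n → Set
Planar {n} G =
  Σ (RotationSystem G) λ ρ →
  Σ ℕ λ c → Σ (Fin n → Fin c) λ comp →
  Σ ℕ λ f → Σ (Dart G → Fin f) λ face →
    (∀ i → ∃ λ a → comp a ≡ i) ×
    (∀ a b → (comp a ≡ comp b) ⇔ Reach (adj G) a b) ×
    (∀ i → ∃ λ d → face d ≡ i) ×
    (∀ d e → (face d ≡ face e) ⇔ SameFace ρ d e) ×
    -- Euler: n − |E| + (f + #isolated) = 2c, multiplied by 2
    (2 * (n + (f + numIsolated G)) ≡ numDarts G + 4 * c)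

steps : {V : Set} → List V → List (V × V)
steps (a ∷ b ∷ r) = (a , b) ∷ steps (b ∷ r)
steps _           = []

SameEdge : {V : Set} → V × V → V × V → Set
SameEdge (a , b) (c , d) = (a ≡ c × b ≡ d) ⊎ (a ≡ d × b ≡ c)

-- A trail of length L starting at x: vertex sequence x, w₁, …, w_L with
-- consecutive vertices adjacent and no edge used twice.
TrailFrom : {V : Set} → (V → V → Bool) → V → ℕ → Set
TrailFrom {V} adj x L =
  Σ (List V) λ ws →
    length ws ≡ L ×
    All (λ { (a , b) → Adj adj a b }) (steps (x ∷ ws)) ×
    AllPairs (λ e e′ → ¬ SameEdge e e′) (steps (x ∷ ws))

cycleEdges : {V : Set} → List V → List (V × V)
cycleEdges []       = []
cycleEdges (w ∷ ws) = steps (w ∷ ws ++ w ∷ [])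

HamCycleThrough : ∀ {n} → SimpleGraph n → Fin n → Fin n → Set
HamCycleThrough {n} G u v =
  Σ (List (Fin n)) λ ws →
    Unique ws ×
    (∀ a → a ∈ ws) ×
    length ws ≥ 3 ×
    All (λ { (a , b) → Adj (adj G) a b }) (cycleEdges ws) ×
    Any (SameEdge (u , v)) (cycleEdges ws)

data Copy : Set where
  A B C D : Copy

data Idx : Set where
  g1 g2 g3 g4 g5 g6 g7 g8 : Idx

-- each edge of W listed once:
-- 8-cycle g1g2g3g4g5g8g7g6g1 and chords g2g7, g3g8, g5g6
wHalf : Idx → Idx → Bool
wHalf g1 g2 = true
wHalf g2 g3 = true
wHalf g3 g4 = true
wHalf g4 g5 = true
wHalf g5 g8 = true
wHalf g8 g7 = true
wHalf g7 g6 = true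
wHalf g6 g1 = true
wHalf g2 g7 = true
wHalf g3 g8 = true
wHalf g5 g6 = true
wHalf _  _  = false

sameCopy : Copy → Copy → Bool
sameCopy A A = true
sameCopy B B = true
sameCopy C C = true
sameCopy D D = true
sameCopy _ _ = false

data GV : Set where
  gv : Copy → Idx → GV
  x y : GV

gHalf : GV → GV → Bool
gHalf (gv c i) (gv c′ j) = sameCopy c c′ ∧ wHalf i j
gHalf (gv A g4) x = true
gHalf x (gv B g1) = true
gHalf x (gv D g1) = true
gHalf (gv B g4) y = true
gHalf (gv D g4) y = true
gHalf y (gv C g1) = true
gHalf _ _ = false

-- vertex set of G′ : V(G) ⊎ gadget vertices  (|V(G′)| = n + 34)
_==_ : ∀ {n} → Fin n → Fin n → Bool
a == b = ⌊ a ≟ b ⌋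

gadgetHalf : ∀ {n} → SimpleGraph n → Fin n → Fin n → Fin n ⊎ GV → Fin n ⊎ GV → Bool
gadgetHalf G u v (inj₁ a) (inj₁ b) =
  adj G a b ∧ not ((a == u ∧ b == v) ∨ (a == v ∧ b == u))
gadgetHalf G u v (inj₁ a) (inj₂ (gv A g1)) = a == u
gadgetHalf G u v (inj₂ (gv C g4)) (inj₁ b) = b == v
gadgetHalf G u v (inj₂ p) (inj₂ q) = gHalf p q
gadgetHalf G u v _ _ = false

gadgetAdj : ∀ {n} → SimpleGraph n → Fin n → Fin n → Fin n ⊎ GV → Fin n ⊎ GV → Bool
gadgetAdj G u v p q = gadgetHalf G u v p q ∨ gadgetHalf G u v q p

-- Every copy of W has the Hamiltonian path g1 g2 g7 g6 g5 g8 g3 g4 between its two vertices of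
-- degree 2. Hence a Hamiltonian path of G − uv from v to u extends through the gadget to the trail
-- x B y C (v … u) A x D y of G′, which has length n + 35 (and symmetrically for a path from u to v).
-- Conversely, in a graph of maximum degree 3 no interior vertex of a trail repeats, so a trail of
-- length n + 35 from x has all n + 34 vertices of G′ in its interior. G and the gadget are joined only
-- by the port edges u g1^A and v g4^C. A trail that entered G once and ended there would still have
-- to enter and leave the copies A and C, whose other boundary edges are x g4^A and y g1^C, and so
-- would cross into G along both port edges, which is impossible with a single crossing. So the trail
-- enters G through one port and leaves through the other, never returning; the part inside G is a
-- Hamiltonian path of G − uv between u and v, which uv closes to a Hamiltonian cycle.

module Submission where

open import Defs
open import Data.Bool using (Bool; true; false; T; not; _∧_; _∨_)
open import Data.Bool.Properties using (∨-comm; T-∨; T-∧)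
open import Data.Empty using (⊥; ⊥-elim)
open import Data.Fin as Fin using (Fin)
open import Data.List
  using (List; []; _∷_; _++_; length; map; filter; allFin; drop; reverse; cartesianProductWith)
import Data.List.Properties as List
open import Data.List.Membership.Propositional using (_∈_; _∉_; find; lose)
open import Data.List.Membership.Propositional.Properties
  using (∈-∃++; ∈-++⁻; ∈-++⁺ˡ; ∈-++⁺ʳ; ∈-map⁺; ∈-map⁻; ∈-filter⁺; ∈-allFin; ∈-cartesianProductWith⁺)
import Data.List.Membership.DecPropositional as Membership
open import Data.List.Relation.Unary.All as All using (All; []; _∷_)
import Data.List.Relation.Unary.All.Properties as All
open import Data.List.Relation.Unary.AllPairs using (AllPairs; []; _∷_; allPairs?)
import Data.List.Relation.Unary.AllPairs.Properties as AllPairs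
open import Data.List.Relation.Unary.Any using (here; there)
open import Data.List.Relation.Unary.Unique.Propositional using (Unique)
import Data.List.Relation.Unary.Unique.Propositional.Properties as Unique
open import Data.List.Relation.Binary.Permutation.Propositional using (_↭_; ↭-refl; ↭-sym; ↭-trans; ↭⇒↭ₛ)
open import Data.List.Relation.Binary.Permutation.Propositional.Properties
  using (∷↭∷ʳ; ∈-resp-↭; All-resp-↭; ↭-length)
import Data.List.Relation.Binary.Permutation.Setoid.Properties as Permutation
open import Data.Nat as ℕ using (ℕ; suc; _+_; _≤_; s≤s; z≤n)
open import Data.Nat.Properties
  using (suc-injective; <-irrefl; ≤-trans; ≤-reflexive; ≤-antisym; +-comm; +-assoc)
open import Data.Nat.Tactic.RingSolver using (solve-∀)
open import Data.Product as Product using (∃; ∃₂; _×_; _,_; proj₁; proj₂)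
open import Data.Sum as Sum using (_⊎_; inj₁; inj₂)
import Data.Sum.Properties as Sum
open import Function using (case_of_; id)
open import Function.Bundles using (Equivalence; _⇔_; mk⇔)
open import Relation.Binary.Definitions using (DecidableEquality)
open import Relation.Binary.PropositionalEquality
  using (setoid; _≡_; _≢_; refl; sym; trans; cong; cong₂; subst; subst₂; module ≡-Reasoning)
open import Relation.Nullary using (¬_; Dec; yes; no)
open import Relation.Nullary.Decidable
  using (T?; ¬?; map′; _×-dec_; _⊎-dec_; _→-dec_; toWitness; fromWitness; from-yes)

+-middle : ∀ a b c → a + (b + c) ≡ b + (a + c)
+-middle = solve-∀

-- Walks given by their vertex lists

Distinct : {V : Set} → V × V → V × V → Set
Distinct e e′ = ¬ SameEdge e e′

SameEdge? : {V : Set} → DecidableEquality V → (s s′ : V × V) → Dec (SameEdge s s′)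
SameEdge? _≟_ (a , b) (c , d) = ((a ≟ c) ×-dec (b ≟ d)) ⊎-dec ((a ≟ d) ×-dec (b ≟ c))

module _ {V : Set} where

  last : V → List V → V
  last a []      = a
  last _ (b ∷ l) = last b l

  last-++ : ∀ a l b r → last a (l ++ b ∷ r) ≡ last b r
  last-++ a []      b r = refl
  last-++ a (c ∷ l) b r = last-++ c l b r

  last-≡++ : ∀ {a : V} {l} xs {b r} → a ∷ l ≡ xs ++ b ∷ r → last a l ≡ last b r
  last-≡++ []       refl = refl
  last-≡++ (c ∷ xs) {b} {r} refl = last-++ c xs b r

  last∈ : ∀ a l → last a l ∈ a ∷ l
  last∈ a []      = here refl
  last∈ a (b ∷ l) = there (last∈ b l)

  init : V → List V → List V
  init a []      = []
  init a (b ∷ l) = a ∷ init b l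

  init-last : ∀ a l → a ∷ l ≡ init a l ++ last a l ∷ []
  init-last a []      = refl
  init-last a (b ∷ l) = cong (a ∷_) (init-last b l)

  length-init : ∀ a l → length (init a l) ≡ length l
  length-init a []      = refl
  length-init a (b ∷ l) = cong suc (length-init b l)

  steps-++ : ∀ a l b r → steps (a ∷ l ++ b ∷ r) ≡ steps (a ∷ l) ++ (last a l , b) ∷ steps (b ∷ r)
  steps-++ a []      b r = refl
  steps-++ a (c ∷ l) b r = cong ((a , c) ∷_) (steps-++ c l b r)

  steps-split : ∀ l (a b : V) r → steps (l ++ a ∷ b ∷ r) ≡ steps (l ++ a ∷ []) ++ (a , b) ∷ steps (b ∷ r)
  steps-split []          a b r = refl
  steps-split (c ∷ [])    a b r = refl
  steps-split (c ∷ d ∷ l) a b r = cong ((c , d) ∷_) (steps-split (d ∷ l) a b r)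

  steps-prefix : ∀ (l r : List V) → ∃ λ S → steps (l ++ r) ≡ steps l ++ S
  steps-prefix []          r = steps r , refl
  steps-prefix (a ∷ [])    r = steps (a ∷ r) , refl
  steps-prefix (a ∷ b ∷ l) r with steps-prefix (b ∷ l) r
  ... | S , eq = S , cong ((a , b) ∷_) eq

  steps-map : ∀ {W : Set} (f : V → W) l → steps (map f l) ≡ map (Product.map f f) (steps l)
  steps-map f []          = refl
  steps-map f (a ∷ [])    = refl
  steps-map f (a ∷ b ∷ l) = cong ((f a , f b) ∷_) (steps-map f (b ∷ l))

  ∈-steps⁻ : ∀ {a b : V} l → (a , b) ∈ steps l → a ∈ l × b ∈ l
  ∈-steps⁻ (c ∷ d ∷ l) (here refl) = here refl , there (here refl)
  ∈-steps⁻ (c ∷ d ∷ l) (there s)   with ∈-steps⁻ (d ∷ l) s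
  ... | a∈ , b∈ = there a∈ , there b∈

  ∈-steps-∷⁻ : ∀ {a b c : V} l → (a , b) ∈ steps (c ∷ l) → b ∈ l
  ∈-steps-∷⁻ (d ∷ l) (here refl) = here refl
  ∈-steps-∷⁻ (d ∷ l) (there s∈)  = proj₂ (∈-steps⁻ (d ∷ l) s∈)

  SameEdge-sym : ∀ {e e′ : V × V} → SameEdge e e′ → SameEdge e′ e
  SameEdge-sym (inj₁ (refl , refl)) = inj₁ (refl , refl)
  SameEdge-sym (inj₂ (refl , refl)) = inj₂ (refl , refl)

  SameEdge-trans : ∀ {e e′ e″ : V × V} → SameEdge e e′ → SameEdge e′ e″ → SameEdge e e″
  SameEdge-trans (inj₁ (refl , refl)) q = q
  SameEdge-trans (inj₂ (refl , refl)) (inj₁ (refl , refl)) = inj₂ (refl , refl)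
  SameEdge-trans (inj₂ (refl , refl)) (inj₂ (refl , refl)) = inj₁ (refl , refl)

  SameEdge-flip : ∀ {a b : V} {e} → SameEdge (a , b) e → SameEdge (b , a) e
  SameEdge-flip = SameEdge-trans (inj₂ (refl , refl))

  AllPairs-++⁻ : ∀ {R : V → V → Set} l {r} → AllPairs R (l ++ r) →
                 AllPairs R l × AllPairs R r × All (λ a → All (R a) r) l
  AllPairs-++⁻ []      rs        = [] , rs , []
  AllPairs-++⁻ (a ∷ l) (ar ∷ rs) with AllPairs-++⁻ l rs
  ... | ls , rs′ , lr = All.++⁻ˡ l ar ∷ ls , rs′ , All.++⁻ʳ l ar ∷ lr

  length-filter-T? : (f : V → Bool) → ∀ l → length (filter (λ a → T? (f a)) l) ≡ countTrue (map f l)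
  length-filter-T? f []      = refl
  length-filter-T? f (a ∷ l) with f a
  ... | true  = cong suc (length-filter-T? f l)
  ... | false = length-filter-T? f l

  ∈-++-drop : ∀ {a b : V} l {r} → b ∈ l ++ a ∷ r → a ≢ b → b ∈ l ++ r
  ∈-++-drop []      (here refl) a≢b = ⊥-elim (a≢b refl)
  ∈-++-drop []      (there b∈)  _   = b∈
  ∈-++-drop (c ∷ l) (here refl) _   = here refl
  ∈-++-drop (c ∷ l) (there b∈)  a≢b = there (∈-++-drop l b∈ a≢b)

  Unique⊆⇒length≤ : ∀ {l r : List V} → Unique l → (∀ {a} → a ∈ l → a ∈ r) → length l ≤ length r
  Unique⊆⇒length≤ {[]}    _            _   = z≤n
  Unique⊆⇒length≤ {a ∷ l} (a∉l ∷ uniq) l⊆r with ∈-∃++ (l⊆r (here refl))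
  ... | r₁ , r₂ , refl = subst (suc (length l) ≤_) (sym (List.length-++-sucʳ r₁ a r₂))
    (s≤s (Unique⊆⇒length≤ uniq (λ b∈l → ∈-++-drop r₁ (l⊆r (there b∈l)) (All.lookup a∉l b∈l))))

  Unique∧length≥⇒∈ : DecidableEquality V → ∀ {E M : List V} → (∀ a → a ∈ E) → Unique M →
                     length E ≤ length M → ∀ a → a ∈ M
  Unique∧length≥⇒∈ _≟_ {E} {M} complete uniq long a with Membership._∈?_ _≟_ a M
  ... | yes a∈M = a∈M
  ... | no  a∉M =
    ⊥-elim (<-irrefl refl (≤-trans (Unique⊆⇒length≤ (a≢M ∷ uniq) (λ {b} _ → complete b)) long))
    where
      a≢M : All (a ≢_) M
      a≢M = All.tabulate λ { b∈M refl → a∉M b∈M }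

  Unique-resp-↭ : ∀ {l l′ : List V} → l ↭ l′ → Unique l → Unique l′
  Unique-resp-↭ σ = Permutation.Unique-resp-↭ (setoid V) (↭⇒↭ₛ σ)

  Unique⇒distinct-steps : ∀ {l : List V} → Unique l → AllPairs Distinct (steps l)
  Unique⇒distinct-steps {[]}        _           = []
  Unique⇒distinct-steps {a ∷ []}    _           = []
  Unique⇒distinct-steps {a ∷ b ∷ r} (a∉ ∷ uniq) = All.tabulate apart ∷ Unique⇒distinct-steps uniq
    where
      apart : ∀ {s} → s ∈ steps (b ∷ r) → Distinct (a , b) s
      apart {c , d} s∈ (inj₁ (refl , _)) = All.lookup a∉ (proj₁ (∈-steps⁻ (b ∷ r) s∈)) refl
      apart {c , d} s∈ (inj₂ (refl , _)) = All.lookup a∉ (proj₂ (∈-steps⁻ (b ∷ r) s∈)) refl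

  cycleEdges-∷ : ∀ (c : V) R → cycleEdges (c ∷ R) ≡ steps (c ∷ R) ++ (last c R , c) ∷ []
  cycleEdges-∷ c R = steps-++ c R c []

  closing-edge-once : ∀ (c : V) R → Unique (c ∷ R) → 3 ≤ length (c ∷ R) →
                      ∀ {s} → s ∈ steps (c ∷ R) → Distinct s (last c R , c)
  closing-edge-once c R (c∉R ∷ _) _ {a , b} s∈ (inj₁ (refl , refl)) = All.lookup c∉R (∈-steps-∷⁻ R s∈) refl
  closing-edge-once c (d ∷ R) (c∉R ∷ _) _ {a , b} (there s∈) (inj₂ (refl , refl)) =
    All.lookup c∉R (proj₁ (∈-steps⁻ (d ∷ R) s∈)) refl
  closing-edge-once c (d ∷ []) _ (s≤s (s≤s ())) (here _) (inj₂ _)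
  closing-edge-once c (d ∷ e ∷ R) (_ ∷ d∉ ∷ _) _ (here refl) (inj₂ (refl , d≡last)) =
    All.lookup d∉ (last∈ e R) d≡last

  cycleEdges-rotate : ∀ (w w′ : V) r →
    cycleEdges (w′ ∷ r ++ w ∷ []) ≡ steps (w′ ∷ r ++ w ∷ []) ++ (w , w′) ∷ []
  cycleEdges-rotate w w′ r = trans (cycleEdges-∷ w′ (r ++ w ∷ []))
    (cong (λ z → steps (w′ ∷ r ++ w ∷ []) ++ (z , w′) ∷ []) (last-++ w′ r w []))

  cycleEdges-rotate-↭ : ∀ (w w′ : V) r → cycleEdges (w′ ∷ r ++ w ∷ []) ↭ cycleEdges (w ∷ w′ ∷ r)
  cycleEdges-rotate-↭ w w′ r =
    subst (_↭ cycleEdges (w ∷ w′ ∷ r)) (sym (cycleEdges-rotate w w′ r)) (↭-sym (∷↭∷ʳ (w , w′) _))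

  rotate-to-end : ∀ (ws : List V) E₁ {s E₂} → cycleEdges ws ≡ E₁ ++ s ∷ E₂ →
    ∃₂ λ c R → c ∷ R ↭ ws × cycleEdges (c ∷ R) ↭ cycleEdges ws × s ≡ (last c R , c)
  rotate-to-end []           []          ()
  rotate-to-end []           (_ ∷ _)     ()
  rotate-to-end (w ∷ [])     []          refl = w , [] , ↭-refl , ↭-refl , refl
  rotate-to-end (w ∷ [])     (_ ∷ [])    ()
  rotate-to-end (w ∷ [])     (_ ∷ _ ∷ _) ()
  rotate-to-end (w ∷ w′ ∷ r) []          refl =
    w′ , r ++ w ∷ [] , ↭-sym (∷↭∷ʳ w (w′ ∷ r)) , cycleEdges-rotate-↭ w w′ r ,
    cong (_, w′) (sym (last-++ w′ r w []))
  rotate-to-end (w ∷ w′ ∷ r) (e ∷ E₁) {s} {E₂} eq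
    with rotate-to-end (w′ ∷ r ++ w ∷ []) E₁ {s} {E₂ ++ (w , w′) ∷ []}
           (trans (cycleEdges-rotate w w′ r)
             (trans (cong (_++ (w , w′) ∷ []) (List.∷-injectiveʳ eq)) (List.++-assoc E₁ (s ∷ E₂) _)))
  ... | c , R , σ , τ , s≡ =
    c , R , ↭-trans σ (↭-sym (∷↭∷ʳ w (w′ ∷ r))) , ↭-trans τ (cycleEdges-rotate-↭ w w′ r) , s≡

last-map : ∀ {V W : Set} (f : V → W) a l → last (f a) (map f l) ≡ f (last a l)
last-map f a []      = refl
last-map f a (b ∷ l) = last-map f b l

-- Trails

module Trails {V : Set} (adj : V → V → Bool) where

  Edge : V × V → Set
  Edge (a , b) = Adj adj a b

  record IsTrail (t : List V) : Set where
    constructor trail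
    field
      edges    : All Edge (steps t)
      distinct : AllPairs Distinct (steps t)

  IsTrail-tail : ∀ {a t} → IsTrail (a ∷ t) → IsTrail t
  IsTrail-tail {t = []}    _                         = trail [] []
  IsTrail-tail {t = b ∷ t} (trail (_ ∷ es) (_ ∷ ds)) = trail es ds

  IsTrail-suffix : ∀ l {t} → IsTrail (l ++ t) → IsTrail t
  IsTrail-suffix []      τ = τ
  IsTrail-suffix (a ∷ l) τ = IsTrail-suffix l (IsTrail-tail τ)

  IsTrail-prefix : ∀ t {r} → IsTrail (t ++ r) → IsTrail t
  IsTrail-prefix t {r} (trail es ds) with steps-prefix t r
  ... | S , eq = trail (All.++⁻ˡ (steps t) (subst (All Edge) eq es))
                       (proj₁ (AllPairs-++⁻ (steps t) (subst (AllPairs Distinct) eq ds)))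

  Enters Leaves : (V → Bool) → V × V → Set
  Enters S (a , b) = ¬ T (S a) × T (S b)
  Leaves S (a , b) = T (S a) × ¬ T (S b)

  exit-step : ∀ S a l → T (S a) → ¬ T (S (last a l)) → ∃ λ s → s ∈ steps (a ∷ l) × Leaves S s
  exit-step S a []      Sa ¬Sl = ⊥-elim (¬Sl Sa)
  exit-step S a (b ∷ l) Sa ¬Sl with T? (S b)
  ... | no ¬Sb = (a , b) , here refl , Sa , ¬Sb
  ... | yes Sb with exit-step S b l Sb ¬Sl
  ...   | s , s∈ , lv = s , there s∈ , lv

  entry-and-exit : ∀ S a l {w} → AllPairs Distinct (steps (a ∷ l)) →
    ¬ T (S a) → ¬ T (S (last a l)) → w ∈ a ∷ l → T (S w) →
    ∃₂ λ s₁ s₂ → s₁ ∈ steps (a ∷ l) × s₂ ∈ steps (a ∷ l) × Enters S s₁ × Leaves S s₂ × Distinct s₁ s₂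
  entry-and-exit S a l       ds       ¬Sa ¬Sl (here refl) Sw = ⊥-elim (¬Sa Sw)
  entry-and-exit S a (b ∷ l) (d ∷ ds) ¬Sa ¬Sl (there w∈)  Sw with T? (S b)
  ... | yes Sb with exit-step S b l Sb ¬Sl
  ...   | s₂ , s₂∈ , lv = (a , b) , s₂ , here refl , there s₂∈ , (¬Sa , Sb) , lv , All.lookup d s₂∈
  entry-and-exit S a (b ∷ l) (d ∷ ds) ¬Sa ¬Sl (there w∈) Sw | no ¬Sb
    with entry-and-exit S b l ds ¬Sb ¬Sl w∈ Sw
  ... | s₁ , s₂ , s₁∈ , s₂∈ , en , lv , s₁#s₂ = s₁ , s₂ , there s₁∈ , there s₂∈ , en , lv , s₁#s₂

  Boundary : (V → Bool) → V × V → V × V → Set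
  Boundary S e₁ e₂ = ∀ {a b} → Adj adj a b → T (S b) → ¬ T (S a) → SameEdge (a , b) e₁ ⊎ SameEdge (a , b) e₂

  Uses : List V → V × V → Set
  Uses t e = ∃ λ s → s ∈ steps t × SameEdge s e

  Subcubic : Set
  Subcubic = ∀ a → ∃ λ (N : List V) → length N ≤ 3 × (∀ {b} → Adj adj a b → b ∈ N)

  module Undirected (adj-sym : ∀ {a b} → Adj adj a b → Adj adj b a) where

    boundary-edges-used : ∀ {S e₁ e₂} → Boundary S e₁ e₂ → ∀ a l {w} → IsTrail (a ∷ l) →
      ¬ T (S a) → ¬ T (S (last a l)) → w ∈ a ∷ l → T (S w) → Uses (a ∷ l) e₁ × Uses (a ∷ l) e₂
    boundary-edges-used {S} boundary a l (trail es ds) ¬Sa ¬Sl w∈ Sw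
      with entry-and-exit S a l ds ¬Sa ¬Sl w∈ Sw
    ... | (a₁ , b₁) , (a₂ , b₂) , s₁∈ , s₂∈ , (¬Sa₁ , Sb₁) , (Sa₂ , ¬Sb₂) , s₁#s₂
      with boundary (All.lookup es s₁∈) Sb₁ ¬Sa₁ | boundary (adj-sym (All.lookup es s₂∈)) Sa₂ ¬Sb₂
    ... | inj₁ g₁ | inj₂ g₂ = (_ , s₁∈ , g₁) , (_ , s₂∈ , SameEdge-flip g₂)
    ... | inj₂ g₁ | inj₁ g₂ = (_ , s₂∈ , SameEdge-flip g₂) , (_ , s₁∈ , g₁)
    ... | inj₁ g₁ | inj₁ g₂ = ⊥-elim (s₁#s₂ (SameEdge-trans g₁ (SameEdge-sym (SameEdge-flip g₂))))
    ... | inj₂ g₁ | inj₂ g₂ = ⊥-elim (s₁#s₂ (SameEdge-trans g₁ (SameEdge-sym (SameEdge-flip g₂))))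

    module Subcubic-trails (adj-irrefl : ∀ {a} → ¬ Adj adj a a) (subcubic : Subcubic) where

      no-four-neighbours : ∀ {a b₁ b₂ b₃ b₄} → Adj adj a b₁ → Adj adj a b₂ → Adj adj a b₃ → Adj adj a b₄ →
                           Unique (b₁ ∷ b₂ ∷ b₃ ∷ b₄ ∷ []) → ⊥
      no-four-neighbours {a} e₁ e₂ e₃ e₄ uniq with subcubic a
      ... | N , |N|≤3 , nbrs⊆N with ≤-trans (Unique⊆⇒length≤ uniq b∈N) |N|≤3
        where
          b∈N : ∀ {b} → b ∈ _ → b ∈ N
          b∈N (here refl)                         = nbrs⊆N e₁
          b∈N (there (here refl))                 = nbrs⊆N e₂
          b∈N (there (there (here refl)))         = nbrs⊆N e₃
          b∈N (there (there (there (here refl)))) = nbrs⊆N e₄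
      ... | s≤s (s≤s (s≤s ()))

      interior-visit : ∀ a M z {w} → w ∈ M → AllPairs Distinct (steps (a ∷ M ++ z ∷ [])) →
        ∃₂ λ (p q : V) → (p , w) ∈ steps (a ∷ M ++ z ∷ []) × (w , q) ∈ steps (a ∷ M ++ z ∷ []) × p ≢ q
      interior-visit a (w ∷ [])    z (here refl) (d ∷ _) =
        a , z , here refl , there (here refl) , λ a≡z → All.lookup d (here refl) (inj₂ (a≡z , refl))
      interior-visit a (w ∷ b ∷ M) z (here refl) (d ∷ _) =
        a , b , here refl , there (here refl) , λ a≡b → All.lookup d (here refl) (inj₂ (a≡b , refl))
      interior-visit a (b ∷ M) z (there w∈) (_ ∷ ds) with interior-visit b M z w∈ ds
      ... | p , q , pw , wq , p≢q = p , q , there pw , there wq , p≢q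

      -- a second interior visit of m would give m four distinct trail edges, hence four neighbours
      no-interior-revisit : ∀ a m M z → IsTrail (a ∷ m ∷ M ++ z ∷ []) → m ∉ M
      no-interior-revisit a m (h ∷ M) z (trail (_ ∷ mh ∷ _) _) (here refl) = adj-irrefl mh
      no-interior-revisit a m (h ∷ M) z (trail (am ∷ mh ∷ es) ((am#mh ∷ am#) ∷ mh# ∷ ds)) (there m∈M)
        with interior-visit h M z m∈M ds
      ... | p , q , pm , mq , p≢q =
        no-four-neighbours (adj-sym am) mh (adj-sym (All.lookup es pm)) (All.lookup es mq)
          ((a≢h ∷ a≢p ∷ a≢q ∷ []) ∷ (h≢p ∷ h≢q ∷ []) ∷ (p≢q ∷ []) ∷ [] ∷ [])
        where
          a≢h : a ≢ h
          a≢h a≡h = am#mh (inj₂ (a≡h , refl))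
          a≢p : a ≢ p
          a≢p a≡p = All.lookup am# pm (inj₁ (a≡p , refl))
          a≢q : a ≢ q
          a≢q a≡q = All.lookup am# mq (inj₂ (a≡q , refl))
          h≢p : h ≢ p
          h≢p h≡p = All.lookup mh# pm (inj₂ (refl , h≡p))
          h≢q : h ≢ q
          h≢q h≡q = All.lookup mh# mq (inj₁ (refl , h≡q))

      interior-unique : ∀ a M z → IsTrail (a ∷ M ++ z ∷ []) → Unique M
      interior-unique a []      z _ = []
      interior-unique a (m ∷ M) z τ =
        All.tabulate (λ { m′∈M refl → no-interior-revisit a m M z τ m′∈M })
        ∷ interior-unique m M z (IsTrail-tail τ)

-- Walks in a disjoint union

module _ {A B : Set} where

  private
    isLeft : A ⊎ B → ℕ
    isLeft (inj₁ _) = 1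
    isLeft (inj₂ _) = 0

  leftEnds : (A ⊎ B) × (A ⊎ B) → ℕ
  leftEnds (a , b) = isLeft a + isLeft b

  leftEnds-SameEdge : ∀ {s s′} → SameEdge s s′ → leftEnds s ≡ leftEnds s′
  leftEnds-SameEdge {a , b} (inj₁ (refl , refl)) = refl
  leftEnds-SameEdge {a , b} (inj₂ (refl , refl)) = +-comm (isLeft a) (isLeft b)

  Distinct-by-leftEnds : ∀ {s s′ m k} → m ≢ k → leftEnds s ≡ m → leftEnds s′ ≡ k → Distinct s s′
  Distinct-by-leftEnds m≢k refl refl same = m≢k (leftEnds-SameEdge same)

  leftEnds-steps₁ : ∀ l → All (λ s → leftEnds s ≡ 2) (steps (map (inj₁ {B = B}) l))
  leftEnds-steps₁ []          = []
  leftEnds-steps₁ (a ∷ [])    = []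
  leftEnds-steps₁ (a ∷ b ∷ l) = refl ∷ leftEnds-steps₁ (b ∷ l)

  leftEnds-steps₂ : ∀ l → All (λ s → leftEnds s ≡ 0) (steps (map (inj₂ {A = A}) l))
  leftEnds-steps₂ []          = []
  leftEnds-steps₂ (a ∷ [])    = []
  leftEnds-steps₂ (a ∷ b ∷ l) = refl ∷ leftEnds-steps₂ (b ∷ l)

  data AfterRun : List (A ⊎ B) → Set where
    done  : AfterRun []
    leave : ∀ r R → AfterRun (inj₂ r ∷ R)

  record FirstRun (t : List (A ⊎ B)) : Set where
    constructor run
    field
      before : List B
      gate   : B
      first  : A
      rest   : List A
      after  : List (A ⊎ B)
      shape  : t ≡ map inj₂ before ++ inj₂ gate ∷ map inj₁ (first ∷ rest) ++ after
      ends   : AfterRun after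

  left-run : ∀ (c : A) l → ∃₂ λ R β → inj₁ c ∷ l ≡ map inj₁ (c ∷ R) ++ β × AfterRun β
  left-run c []           = [] , [] , refl , done
  left-run c (inj₂ r ∷ l) = [] , inj₂ r ∷ l , refl , leave r l
  left-run c (inj₁ d ∷ l) with left-run d l
  ... | R , β , eq , ends = d ∷ R , β , cong (inj₁ c ∷_) eq , ends

  first-run : ∀ (b : B) l {a} → inj₁ a ∈ l → FirstRun (inj₂ b ∷ l)
  first-run b (inj₁ c ∷ l) _ with left-run c l
  ... | R , β , eq , ends = run [] b c R β (cong (inj₂ b ∷_) eq) ends
  first-run b (inj₂ q ∷ l) (there a∈) with first-run q l a∈
  ... | run α p c R β eq ends = run (b ∷ α) p c R β (cong (inj₂ b ∷_) eq) ends

  crossing-is-junction : ∀ α p c R {s} → s ∈ steps (map inj₂ α ++ inj₂ p ∷ map inj₁ (c ∷ R)) →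
                         leftEnds s ≡ 1 → s ≡ (inj₂ p , inj₁ c)
  crossing-is-junction α p c R {s} s∈ one
    with ∈-++⁻ (steps (map inj₂ α ++ inj₂ p ∷ []))
               (subst (s ∈_) (steps-split (map inj₂ α) (inj₂ p) (inj₁ c) (map inj₁ R)) s∈)
  ... | inj₁ s∈α         = case trans (sym one) (All.lookup before-run s∈α) of λ ()
    where
      before-run : All (λ s → leftEnds s ≡ 0) (steps (map inj₂ α ++ inj₂ p ∷ []))
      before-run = subst (λ l → All (λ s → leftEnds s ≡ 0) (steps l))
                         (List.map-++ inj₂ α (p ∷ [])) (leftEnds-steps₂ (α ++ p ∷ []))
  ... | inj₂ (here eq)   = eq
  ... | inj₂ (there s∈R) = case trans (sym one) (All.lookup (leftEnds-steps₁ (c ∷ R)) s∈R) of λ ()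

  steps-splice : ∀ (b : B) P (c : A) R (q : B) Q →
    steps (map inj₂ (b ∷ P) ++ map inj₁ (c ∷ R) ++ map inj₂ (q ∷ Q)) ≡
    steps (map inj₂ (b ∷ P)) ++ (inj₂ (last b P) , inj₁ c) ∷
      steps (map inj₁ (c ∷ R)) ++ (inj₁ (last c R) , inj₂ q) ∷ steps (map inj₂ (q ∷ Q))
  steps-splice b P c R q Q = begin
    steps (inj₂ b ∷ map inj₂ P ++ inj₁ c ∷ map inj₁ R ++ inj₂ q ∷ map inj₂ Q)
      ≡⟨ steps-++ (inj₂ b) (map inj₂ P) (inj₁ c) _ ⟩
    steps (map inj₂ (b ∷ P)) ++ (last (inj₂ b) (map inj₂ P) , inj₁ c) ∷
      steps (inj₁ c ∷ map inj₁ R ++ inj₂ q ∷ map inj₂ Q)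
      ≡⟨ cong₂ (λ p S → steps (map inj₂ (b ∷ P)) ++ (p , inj₁ c) ∷ S)
               (last-map inj₂ b P) (steps-++ (inj₁ c) (map inj₁ R) (inj₂ q) (map inj₂ Q)) ⟩
    steps (map inj₂ (b ∷ P)) ++ (inj₂ (last b P) , inj₁ c) ∷
      steps (map inj₁ (c ∷ R)) ++ (last (inj₁ c) (map inj₁ R) , inj₂ q) ∷ steps (map inj₂ (q ∷ Q))
      ≡⟨ cong (λ e → steps (map inj₂ (b ∷ P)) ++ (inj₂ (last b P) , inj₁ c) ∷
                       steps (map inj₁ (c ∷ R)) ++ (e , inj₂ q) ∷ steps (map inj₂ (q ∷ Q)))
              (last-map inj₁ c R) ⟩
    steps (map inj₂ (b ∷ P)) ++ (inj₂ (last b P) , inj₁ c) ∷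
      steps (map inj₁ (c ∷ R)) ++ (inj₁ (last c R) , inj₂ q) ∷ steps (map inj₂ (q ∷ Q)) ∎
    where open ≡-Reasoning

  -- only steps with the same number of endpoints in A can be the same edge
  splice-distinct : ∀ b P c R q Q →
    AllPairs Distinct (steps (map inj₂ (b ∷ P)) ++ steps (map inj₂ (q ∷ Q))) →
    AllPairs Distinct (steps (map inj₁ (c ∷ R))) → last b P ≢ q →
    AllPairs Distinct (steps (map inj₂ (b ∷ P) ++ map inj₁ (c ∷ R) ++ map inj₂ (q ∷ Q)))
  splice-distinct b P c R q Q outer inner p≢q with AllPairs-++⁻ (steps (map inj₂ (b ∷ P))) outer
  ... | distinctP , distinctQ , P#Q =
    subst (AllPairs Distinct) (sym (steps-splice b P c R q Q))
      (AllPairs.++⁺ distinctP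
        (entry# ∷ AllPairs.++⁺ inner (apart (λ ()) refl kindQ ∷ distinctQ) (All.map R#after kindR))
        (All.zipWith P#after (kindP , P#Q)))
    where
      SR SQ : List ((A ⊎ B) × (A ⊎ B))
      SR = steps (map inj₁ (c ∷ R))
      SQ = steps (map inj₂ (q ∷ Q))
      entry exit : (A ⊎ B) × (A ⊎ B)
      entry = inj₂ (last b P) , inj₁ c
      exit  = inj₁ (last c R) , inj₂ q
      kindP : All (λ s → leftEnds s ≡ 0) (steps (map inj₂ (b ∷ P)))
      kindP = leftEnds-steps₂ (b ∷ P)
      kindQ : All (λ s → leftEnds s ≡ 0) SQ
      kindQ = leftEnds-steps₂ (q ∷ Q)
      kindR : All (λ s → leftEnds s ≡ 2) SR
      kindR = leftEnds-steps₁ (c ∷ R)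
      apart : ∀ {s S m k} → m ≢ k → leftEnds s ≡ m → All (λ s′ → leftEnds s′ ≡ k) S → All (Distinct s) S
      apart m≢k ks = All.map (Distinct-by-leftEnds m≢k ks)
      entry# : All (Distinct entry) (SR ++ exit ∷ SQ)
      entry# = All.++⁺ (apart (λ ()) refl kindR) (entry#exit ∷ apart (λ ()) refl kindQ)
        where
          entry#exit : Distinct entry exit
          entry#exit (inj₂ (eq , _)) = p≢q (Sum.inj₂-injective eq)
      R#after : ∀ {s} → leftEnds s ≡ 2 → All (Distinct s) (exit ∷ SQ)
      R#after k = Distinct-by-leftEnds (λ ()) k refl ∷ apart (λ ()) k kindQ
      P#after : ∀ {s} → leftEnds s ≡ 0 × All (Distinct s) SQ → All (Distinct s) (entry ∷ SR ++ exit ∷ SQ)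
      P#after (k , s#Q) = Distinct-by-leftEnds (λ ()) k refl
                        ∷ All.++⁺ (apart (λ ()) k kindR) (Distinct-by-leftEnds (λ ()) k refl ∷ s#Q)

  first-run-entry : ∀ {t} (r : FirstRun t) → (inj₂ (FirstRun.gate r) , inj₁ (FirstRun.first r)) ∈ steps t
  first-run-entry (run α p c R β refl _) =
    subst ((inj₂ p , inj₁ c) ∈_) (sym (steps-split (map inj₂ α) (inj₂ p) (inj₁ c) (map inj₁ R ++ β)))
          (∈-++⁺ʳ (steps (map inj₂ α ++ inj₂ p ∷ [])) (here refl))

  ∈-left-run : ∀ {a : A} (α : List B) (p : B) (L : List A) (β : List (A ⊎ B)) →
               inj₁ a ∈ map inj₂ α ++ inj₂ p ∷ map inj₁ L ++ β → a ∈ L ⊎ inj₁ a ∈ β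
  ∈-left-run α p L β a∈ with ∈-++⁻ (map inj₂ α) a∈
  ... | inj₁ a∈α with ∈-map⁻ inj₂ a∈α
  ...   | _ , _ , ()
  ∈-left-run α p L β a∈ | inj₂ (here ())
  ∈-left-run α p L β a∈ | inj₂ (there a∈′) with ∈-++⁻ (map inj₁ L) a∈′
  ... | inj₁ a∈L with ∈-map⁻ inj₁ a∈L
  ...   | _ , a′∈L , refl = inj₁ a′∈L
  ∈-left-run α p L β a∈ | inj₂ (there a∈′) | inj₂ a∈β = inj₂ a∈β

-- The gadget

≟-via-ℕ : {X : Set} (code : X → ℕ) (decode : ℕ → X) → (∀ a → decode (code a) ≡ a) → DecidableEquality X
≟-via-ℕ code decode retract a b =
  map′ (λ eq → trans (sym (retract a)) (trans (cong decode eq) (retract b))) (cong code) (code a ℕ.≟ code b)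

_≟Copy_ : DecidableEquality Copy
_≟Copy_ = ≟-via-ℕ code decode retract
  where
    code : Copy → ℕ
    code A = 0
    code B = 1
    code C = 2
    code D = 3
    decode : ℕ → Copy
    decode 0 = A
    decode 1 = B
    decode 2 = C
    decode _ = D
    retract : ∀ K → decode (code K) ≡ K
    retract A = refl
    retract B = refl
    retract C = refl
    retract D = refl

_≟Idx_ : DecidableEquality Idx
_≟Idx_ = ≟-via-ℕ code decode retract
  where
    code : Idx → ℕ
    code g1 = 0
    code g2 = 1
    code g3 = 2
    code g4 = 3
    code g5 = 4
    code g6 = 5
    code g7 = 6
    code g8 = 7
    decode : ℕ → Idx
    decode 0 = g1
    decode 1 = g2
    decode 2 = g3
    decode 3 = g4
    decode 4 = g5
    decode 5 = g6
    decode 6 = g7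
    decode _ = g8
    retract : ∀ i → decode (code i) ≡ i
    retract g1 = refl
    retract g2 = refl
    retract g3 = refl
    retract g4 = refl
    retract g5 = refl
    retract g6 = refl
    retract g7 = refl
    retract g8 = refl

_≟GV_ : DecidableEquality GV
gv K i ≟GV gv K′ j =
  map′ (λ { (refl , refl) → refl }) (λ { refl → refl , refl }) ((K ≟Copy K′) ×-dec (i ≟Idx j))
gv _ _ ≟GV x       = no λ ()
gv _ _ ≟GV y       = no λ ()
x      ≟GV gv _ _  = no λ ()
x      ≟GV x       = yes refl
x      ≟GV y       = no λ ()
y      ≟GV gv _ _  = no λ ()
y      ≟GV x       = no λ ()
y      ≟GV y       = yes refl

copies : List Copy
copies = A ∷ B ∷ C ∷ D ∷ []

indices : List Idx
indices = g1 ∷ g2 ∷ g3 ∷ g4 ∷ g5 ∷ g6 ∷ g7 ∷ g8 ∷ []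

gadgetVertices : List GV
gadgetVertices = x ∷ y ∷ cartesianProductWith gv copies indices

∈-gadgetVertices : ∀ p → p ∈ gadgetVertices
∈-gadgetVertices x        = here refl
∈-gadgetVertices y        = there (here refl)
∈-gadgetVertices (gv K i) = there (there (∈-cartesianProductWith⁺ gv (∈-copies K) (∈-indices i)))
  where
    ∈-copies : ∀ K → K ∈ copies
    ∈-copies A = here refl
    ∈-copies B = there (here refl)
    ∈-copies C = there (there (here refl))
    ∈-copies D = there (there (there (here refl)))
    ∈-indices : ∀ i → i ∈ indices
    ∈-indices g1 = here refl
    ∈-indices g2 = there (here refl)
    ∈-indices g3 = there (there (here refl))
    ∈-indices g4 = there (there (there (here refl)))
    ∈-indices g5 = there (there (there (there (here refl))))
    ∈-indices g6 = there (there (there (there (there (here refl)))))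
    ∈-indices g7 = there (there (there (there (there (there (here refl))))))
    ∈-indices g8 = there (there (there (there (there (there (there (here refl)))))))

∀-GV? : {P : GV → Set} → (∀ p → Dec (P p)) → Dec (∀ p → P p)
∀-GV? P? = map′ (λ all p → All.lookup all (∈-gadgetVertices p)) (λ all → All.tabulate (λ {p} _ → all p))
                (All.all? P? gadgetVertices)

through : Copy → List GV
through K = map (gv K) (g1 ∷ g2 ∷ g7 ∷ g6 ∷ g5 ∷ g8 ∷ g3 ∷ g4 ∷ [])

-- The graph G′

module Replacement {n : ℕ} (G : SimpleGraph n) (u v : Fin n) (uv : Adj (adj G) u v) where

  V′ : Set
  V′ = Fin n ⊎ GV

  adj′ : V′ → V′ → Bool
  adj′ = gadgetAdj G u v

  open Trails adj′ public

  Adj′ : V′ → V′ → Set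
  Adj′ = Adj adj′

  _≟V′_ : DecidableEquality V′
  _≟V′_ = Sum.≡-dec Fin._≟_ _≟GV_

  adj′-sym : ∀ {a b} → Adj′ a b → Adj′ b a
  adj′-sym {a} {b} = subst T (∨-comm (gadgetHalf G u v a b) (gadgetHalf G u v b a))

  u≢v : u ≢ v
  u≢v refl = subst T (adj-irrefl G u) uv

  private
    not-T : ∀ {b} → ¬ T b → T (not b)
    not-T {false} _  = _
    not-T {true}  ¬t = ¬t _

    T-not : ∀ {b} → T (not b) → ¬ T b
    T-not {false} _ ()

    T==⇒≡ : ∀ {a b : Fin n} → T (a == b) → a ≡ b
    T==⇒≡ {a} {b} = toWitness {a? = a Fin.≟ b}

    ≡⇒T== : ∀ {a b : Fin n} → a ≡ b → T (a == b)
    ≡⇒T== {a} {b} = fromWitness {a? = a Fin.≟ b}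

    isUV : Fin n → Fin n → Bool
    isUV a b = (a == u ∧ b == v) ∨ (a == v ∧ b == u)

    T-isUV⇒ : ∀ a b → T (isUV a b) → SameEdge (a , b) (u , v)
    T-isUV⇒ a b t with Equivalence.to (T-∨ {a == u ∧ b == v} {a == v ∧ b == u}) t
    ... | inj₁ t₁ = inj₁ (Product.map T==⇒≡ T==⇒≡ (Equivalence.to (T-∧ {a == u} {b == v}) t₁))
    ... | inj₂ t₂ = inj₂ (Product.map T==⇒≡ T==⇒≡ (Equivalence.to (T-∧ {a == v} {b == u}) t₂))

    ⇒T-isUV : ∀ a b → SameEdge (a , b) (u , v) → T (isUV a b)
    ⇒T-isUV a b same = Equivalence.from (T-∨ {a == u ∧ b == v} {a == v ∧ b == u}) (Sum.map both both same)
      where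
        both : ∀ {c d} → a ≡ c × b ≡ d → T (a == c ∧ b == d)
        both {c} {d} (a≡c , b≡d) = Equivalence.from (T-∧ {a == c} {b == d}) (≡⇒T== a≡c , ≡⇒T== b≡d)

  inner-edge⇒ : ∀ {a b} → Adj′ (inj₁ a) (inj₁ b) → Adj (adj G) a b × Distinct (a , b) (u , v)
  inner-edge⇒ {a} {b} e
    with Equivalence.to (T-∨ {adj G a b ∧ not (isUV a b)} {adj G b a ∧ not (isUV b a)}) e
  ... | inj₁ e₁ with Equivalence.to (T-∧ {adj G a b}) e₁
  ...   | ab , ¬uv = ab , λ same → T-not ¬uv (⇒T-isUV a b same)
  inner-edge⇒ {a} {b} e | inj₂ e₂ with Equivalence.to (T-∧ {adj G b a}) e₂
  ...   | ba , ¬uv = subst T (adj-sym G b a) ba , λ same → T-not ¬uv (⇒T-isUV b a (SameEdge-flip same))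

  ⇒inner-edge : ∀ {a b} → Adj (adj G) a b → Distinct (a , b) (u , v) → Adj′ (inj₁ a) (inj₁ b)
  ⇒inner-edge {a} {b} ab ¬uv =
    Equivalence.from (T-∨ {adj G a b ∧ not (isUV a b)} {adj G b a ∧ not (isUV b a)})
      (inj₁ (Equivalence.from (T-∧ {adj G a b}) (ab , not-T (λ t → ¬uv (T-isUV⇒ a b t)))))

  data Port : GV → Fin n → Set where
    port-u : Port (gv A g1) u
    port-v : Port (gv C g4) v

  port-edge : ∀ {p b} → Port p b → Adj′ (inj₂ p) (inj₁ b)
  port-edge port-u = ≡⇒T== refl
  port-edge port-v = Equivalence.from (T-∨ {v == v} {false}) (inj₁ (≡⇒T== refl))

  private
    -- the ports are tested first: at them adjacency to the abstract b does not reduce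
    port-candidates : ∀ b p → p ≡ gv A g1 ⊎ p ≡ gv C g4 ⊎ ¬ Adj′ (inj₂ p) (inj₁ b)
    port-candidates b = from-yes (∀-GV? λ p →
      (p ≟GV gv A g1) ⊎-dec (p ≟GV gv C g4) ⊎-dec ¬? (T? (adj′ (inj₂ p) (inj₁ b))))

  port : ∀ p {b} → Adj′ (inj₂ p) (inj₁ b) → Port p b
  port p {b} e with port-candidates b p
  ... | inj₁ refl        = subst (Port (gv A g1)) (sym (T==⇒≡ e)) port-u
  ... | inj₂ (inj₂ ¬e)   = ⊥-elim (¬e e)
  ... | inj₂ (inj₁ refl) with Equivalence.to (T-∨ {b == v} {false}) e
  ...   | inj₁ b≡v = subst (Port (gv C g4)) (sym (T==⇒≡ b≡v)) port-v

  ports-differ : ∀ {p c q e} → Port p c → Port q e → Distinct (inj₂ p , inj₁ c) (inj₁ e , inj₂ q) →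
                 SameEdge (u , v) (e , c)
  ports-differ port-u port-u d = ⊥-elim (d (inj₂ (refl , refl)))
  ports-differ port-u port-v d = inj₂ (refl , refl)
  ports-differ port-v port-u d = inj₁ (refl , refl)
  ports-differ port-v port-v d = ⊥-elim (d (inj₂ (refl , refl)))

  no-third-port : ∀ {p c q e r w} → Port p c → Port q e → Port r w →
    Distinct (inj₂ p , inj₁ c) (inj₁ e , inj₂ q) →
    SameEdge (inj₂ p , inj₁ c) (inj₂ r , inj₁ w) ⊎ SameEdge (inj₁ e , inj₂ q) (inj₂ r , inj₁ w)
  no-third-port port-u port-u _      d = ⊥-elim (d (inj₂ (refl , refl)))
  no-third-port port-v port-v _      d = ⊥-elim (d (inj₂ (refl , refl)))
  no-third-port port-u port-v port-u _ = inj₁ (inj₁ (refl , refl))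
  no-third-port port-u port-v port-v _ = inj₂ (inj₂ (refl , refl))
  no-third-port port-v port-u port-u _ = inj₂ (inj₂ (refl , refl))
  no-third-port port-v port-u port-v _ = inj₁ (inj₁ (refl , refl))

  adj′-irrefl : ∀ {a} → ¬ Adj′ a a
  adj′-irrefl {inj₁ a} e = subst T (adj-irrefl G a) (proj₁ (inner-edge⇒ e))
  adj′-irrefl {inj₂ p}   = from-yes (∀-GV? (λ p → ¬? (T? (adj′ (inj₂ p) (inj₂ p))))) p

  port-at : Fin n → V′
  port-at b with b Fin.≟ u
  ... | yes _ = inj₂ (gv A g1)
  ... | no _  = inj₂ (gv C g4)

  -- the neighbour of b in G′ that takes the place of its neighbour c in G
  replace : Fin n → Fin n → V′
  replace b c with SameEdge? Fin._≟_ (b , c) (u , v)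
  ... | yes _ = port-at b
  ... | no _  = inj₁ c

  replace-inner : ∀ {b c} → Distinct (b , c) (u , v) → replace b c ≡ inj₁ c
  replace-inner {b} {c} ¬uv with SameEdge? Fin._≟_ (b , c) (u , v)
  ... | yes uv′ = ⊥-elim (¬uv uv′)
  ... | no _    = refl

  replace-uv : replace u v ≡ inj₂ (gv A g1)
  replace-uv with SameEdge? Fin._≟_ (u , v) (u , v)
  ... | no ¬uv = ⊥-elim (¬uv (inj₁ (refl , refl)))
  ... | yes _ with u Fin.≟ u
  ...   | yes _   = refl
  ...   | no u≢u  = ⊥-elim (u≢u refl)

  replace-vu : replace v u ≡ inj₂ (gv C g4)
  replace-vu with SameEdge? Fin._≟_ (v , u) (u , v)
  ... | no ¬uv = ⊥-elim (¬uv (inj₂ (refl , refl)))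
  ... | yes _ with v Fin.≟ u
  ...   | no _    = refl
  ...   | yes v≡u = ⊥-elim (u≢v (sym v≡u))

  G-neighbours : Fin n → List (Fin n)
  G-neighbours b = filter (λ c → T? (adj G b c)) (allFin n)

  ∈-G-neighbours : ∀ {b c} → Adj (adj G) b c → c ∈ G-neighbours b
  ∈-G-neighbours {b} {c} = ∈-filter⁺ (λ c → T? (adj G b c)) (∈-allFin c)

  ports : GV → List V′
  ports (gv A g1) = inj₁ u ∷ []
  ports (gv C g4) = inj₁ v ∷ []
  ports _         = []

  gadget-neighbours : GV → List V′
  gadget-neighbours p = map inj₂ (filter (λ q → T? (adj′ (inj₂ p) (inj₂ q))) gadgetVertices)

  neighbours : V′ → List V′
  neighbours (inj₁ b) = map (replace b) (G-neighbours b)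
  neighbours (inj₂ p) = gadget-neighbours p ++ ports p

  ∈-neighbours : ∀ {a b} → Adj′ a b → b ∈ neighbours a
  ∈-neighbours {inj₁ b} {inj₁ c} e with inner-edge⇒ e
  ... | bc , ¬uv =
    subst (_∈ neighbours (inj₁ b)) (replace-inner ¬uv) (∈-map⁺ (replace b) (∈-G-neighbours bc))
  ∈-neighbours {inj₁ b} {inj₂ p} e with port p (adj′-sym {inj₁ b} {inj₂ p} e)
  ... | port-u = subst (_∈ neighbours (inj₁ u)) replace-uv (∈-map⁺ (replace u) (∈-G-neighbours uv))
  ... | port-v = subst (_∈ neighbours (inj₁ v)) replace-vu
                   (∈-map⁺ (replace v) (∈-G-neighbours (subst T (adj-sym G u v) uv)))
  ∈-neighbours {inj₂ p} {inj₂ q} e =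
    ∈-++⁺ˡ (∈-map⁺ inj₂ (∈-filter⁺ (λ q → T? (adj′ (inj₂ p) (inj₂ q))) (∈-gadgetVertices q) e))
  ∈-neighbours {inj₂ p} {inj₁ b} e with port p e
  ... | port-u = ∈-++⁺ʳ (gadget-neighbours (gv A g1)) (here refl)
  ... | port-v = ∈-++⁺ʳ (gadget-neighbours (gv C g4)) (here refl)

  length-G-neighbours : ∀ b → length (G-neighbours b) ≡ degree G b
  length-G-neighbours b = length-filter-T? (adj G b) (allFin n)

  subcubic : Cubic G → Subcubic
  subcubic cubic a = neighbours a , length≤3 a , ∈-neighbours
    where
      length≤3 : ∀ a → length (neighbours a) ≤ 3
      length≤3 (inj₁ b) = ≤-reflexive (trans (List.length-map (replace b) (G-neighbours b))
                                             (trans (length-G-neighbours b) (cubic b)))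
      length≤3 (inj₂ p) = from-yes (∀-GV? (λ p → length (neighbours (inj₂ p)) ℕ.≤? 3)) p

  inCopy : Copy → V′ → Bool
  inCopy K (inj₂ (gv K′ _)) = sameCopy K′ K
  inCopy K _                = false

  copy-boundary : ∀ K {e₁ e₂} →
    (∀ p q → Adj′ (inj₂ p) (inj₂ q) → T (inCopy K (inj₂ q)) → ¬ T (inCopy K (inj₂ p)) →
       SameEdge (inj₂ p , inj₂ q) e₁) →
    (∀ {q w} → Port q w → T (inCopy K (inj₂ q)) → SameEdge (inj₁ w , inj₂ q) e₂) →
    Boundary (inCopy K) e₁ e₂
  copy-boundary K inner outer {inj₂ p} {inj₂ q} e Sq ¬Sp = inj₁ (inner p q e Sq ¬Sp)
  copy-boundary K inner outer {inj₁ w} {inj₂ q} e Sq _   =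
    inj₂ (outer (port q (adj′-sym {inj₁ w} {inj₂ q} e)) Sq)
  copy-boundary K inner outer {b = inj₁ _} _ ()

  private
    inner-boundary? : ∀ K e → Dec (∀ p q → Adj′ (inj₂ p) (inj₂ q) → T (inCopy K (inj₂ q)) →
                                 ¬ T (inCopy K (inj₂ p)) → SameEdge (inj₂ p , inj₂ q) e)
    inner-boundary? K e = ∀-GV? λ p → ∀-GV? λ q →
      T? (adj′ (inj₂ p) (inj₂ q)) →-dec T? (inCopy K (inj₂ q)) →-dec ¬? (T? (inCopy K (inj₂ p))) →-dec
      SameEdge? _≟V′_ (inj₂ p , inj₂ q) e

  A-boundary : Boundary (inCopy A) (inj₂ x , inj₂ (gv A g4)) (inj₁ u , inj₂ (gv A g1))
  A-boundary = copy-boundary A (from-yes (inner-boundary? A (inj₂ x , inj₂ (gv A g4))))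
                            λ { port-u _ → inj₁ (refl , refl) ; port-v () }

  C-boundary : Boundary (inCopy C) (inj₂ y , inj₂ (gv C g1)) (inj₁ v , inj₂ (gv C g4))
  C-boundary = copy-boundary C (from-yes (inner-boundary? C (inj₂ y , inj₂ (gv C g1))))
                            λ { port-u () ; port-v _ → inj₁ (refl , refl) }

  G-Edge : Fin n × Fin n → Set
  G-Edge = Trails.Edge (adj G)

  -- a Hamiltonian path of G − uv, its edges taken in G′, whose ends are joined by uv
  record HamPath (c : Fin n) (R : List (Fin n)) : Set where
    field
      unique   : Unique (c ∷ R)
      complete : ∀ a → a ∈ c ∷ R
      edges    : All Edge (steps (map inj₁ (c ∷ R)))
      closing  : SameEdge (u , v) (last c R , c)

  length-allFin : length (allFin n) ≡ n
  length-allFin = List.length-tabulate id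

  length-HamPath : ∀ {c R} → HamPath c R → length (c ∷ R) ≡ n
  length-HamPath {c} {R} path = ≤-antisym
    (subst (length (c ∷ R) ≤_) length-allFin (Unique⊆⇒length≤ unique (λ {a} _ → ∈-allFin a)))
    (subst (_≤ length (c ∷ R)) length-allFin (Unique⊆⇒length≤ (Unique.allFin⁺ n) (λ {a} _ → complete a)))
    where open HamPath path

  cycle⇒path : HamCycleThrough G u v → ∃₂ HamPath
  cycle⇒path (ws , uniq , complete , long , edges , uv∈) with find uv∈
  ... | s , s∈ , uv≈s with ∈-∃++ s∈
  ... | E₁ , E₂ , split with rotate-to-end ws E₁ split
  ... | c , R , σ , τ , refl = c , R , record
    { unique   = Unique-resp-↭ (↭-sym σ) uniq
    ; complete = λ a → ∈-resp-↭ (↭-sym σ) (complete a)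
    ; edges    = subst (All Edge) (sym (steps-map inj₁ (c ∷ R))) (All.map⁺ (All.tabulate inner))
    ; closing  = uv≈s
    }
    where
      G-edges : All G-Edge (cycleEdges (c ∷ R))
      G-edges = All-resp-↭ (↭-sym τ) (All.map (λ { {_ , _} e → e }) edges)
      path-edges : All G-Edge (steps (c ∷ R))
      path-edges = All.++⁻ˡ (steps (c ∷ R)) (subst (All G-Edge) (cycleEdges-∷ c R) G-edges)
      inner : ∀ {s} → s ∈ steps (c ∷ R) → Edge (Product.map inj₁ inj₁ s)
      inner {a , b} s∈ = ⇒inner-edge (All.lookup path-edges s∈)
        (λ ab≈uv → closing-edge-once c R (Unique-resp-↭ (↭-sym σ) uniq)
                     (subst (3 ≤_) (sym (↭-length σ)) long) s∈ (SameEdge-trans ab≈uv uv≈s))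

  path⇒cycle : Cubic G → ∀ {c R} → HamPath c R → HamCycleThrough G u v
  path⇒cycle cubic {c} {R} path =
    c ∷ R , unique , complete , long , All.map (λ { {_ , _} e → e }) cycle-edges , lose closing∈ closing
    where
      open HamPath path
      long : 3 ≤ length (c ∷ R)
      long = subst (_≤ length (c ∷ R)) (trans (length-G-neighbours u) (cubic u))
               (Unique⊆⇒length≤ (Unique.filter⁺ (λ c → T? (adj G u c)) (Unique.allFin⁺ n))
                                (λ {a} _ → complete a))
      closing-edge : G-Edge (last c R , c)
      closing-edge with closing
      ... | inj₁ (u≡last , v≡c) = subst₂ (Adj (adj G)) u≡last v≡c uv
      ... | inj₂ (u≡c , v≡last) = subst₂ (Adj (adj G)) v≡last u≡c (subst T (adj-sym G u v) uv)
      path-edges : All G-Edge (steps (c ∷ R))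
      path-edges = All.map (λ {s} e → proj₁ (inner-edge⇒ {proj₁ s} {proj₂ s} e))
                     (All.map⁻ (subst (All Edge) (steps-map inj₁ (c ∷ R)) edges))
      cycle-edges : All G-Edge (cycleEdges (c ∷ R))
      cycle-edges = subst (All G-Edge) (sym (cycleEdges-∷ c R)) (All.++⁺ path-edges (closing-edge ∷ []))
      closing∈ : (last c R , c) ∈ cycleEdges (c ∷ R)
      closing∈ = subst ((last c R , c) ∈_) (sym (cycleEdges-∷ c R)) (∈-++⁺ʳ (steps (c ∷ R)) (here refl))

  detour-steps : List GV → GV → List GV → List (V′ × V′)
  detour-steps P q Q = steps (map inj₂ (x ∷ P)) ++ steps (map inj₂ (q ∷ Q))

  spliced-trail : ∀ P q Q {c R} → HamPath c R → Port (last x P) c → Port q (last c R) → last x P ≢ q →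
    All Edge (detour-steps P q Q) × AllPairs Distinct (detour-steps P q Q) →
    length P + length (q ∷ Q) ≡ 35 → TrailFrom adj′ (inj₂ x) (n + 34 + 1)
  spliced-trail P q Q {c} {R} path enter exit p≢q (detour-edges , detour-distinct) length≡35 =
    ws , length≡ , All.map (λ { {_ , _} e → e }) edges ,
    splice-distinct x P c R q Q detour-distinct
      (Unique⇒distinct-steps (Unique.map⁺ Sum.inj₁-injective (HamPath.unique path))) p≢q
    where
      ws : List V′
      ws = map inj₂ P ++ map inj₁ (c ∷ R) ++ map inj₂ (q ∷ Q)
      edges : All Edge (steps (inj₂ x ∷ ws))
      edges = subst (All Edge) (sym (steps-splice x P c R q Q))
                (All.++⁺ (All.++⁻ˡ _ detour-edges)
                  (port-edge enter ∷ All.++⁺ (HamPath.edges path)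
                    (adj′-sym {inj₂ q} {inj₁ (last c R)} (port-edge exit) ∷ All.++⁻ʳ _ detour-edges)))
      length≡ : length ws ≡ n + 34 + 1
      length≡ = begin
        length ws
          ≡⟨ List.length-++ (map inj₂ P) ⟩
        length (map inj₂ P) + length (map inj₁ (c ∷ R) ++ map inj₂ (q ∷ Q))
          ≡⟨ cong₂ _+_ (List.length-map inj₂ P) (List.length-++ (map inj₁ (c ∷ R))) ⟩
        length P + (length (map inj₁ (c ∷ R)) + length (map inj₂ (q ∷ Q)))
          ≡⟨ cong₂ (λ a b → length P + (a + b)) (trans (List.length-map inj₁ (c ∷ R)) (length-HamPath path))
                                                 (List.length-map inj₂ (q ∷ Q)) ⟩
        length P + (n + length (q ∷ Q))
          ≡⟨ +-middle (length P) n (length (q ∷ Q)) ⟩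
        n + (length P + length (q ∷ Q))
          ≡⟨ cong (n +_) length≡35 ⟩
        n + 35
          ≡⟨ +-assoc n 34 1 ⟨
        n + 34 + 1 ∎
        where open ≡-Reasoning

  private
    Edge? : ∀ s → Dec (Edge s)
    Edge? (a , b) = T? (adj′ a b)

    detours? : ∀ P q Q → Dec (All Edge (detour-steps P q Q) × AllPairs Distinct (detour-steps P q Q))
    detours? P q Q = All.all? Edge? _ ×-dec allPairs? (λ s s′ → ¬? (SameEdge? _≟V′_ s s′)) _

  path⇒trail : ∀ {c R} → HamPath c R → TrailFrom adj′ (inj₂ x) (n + 34 + 1)
  path⇒trail path with HamPath.closing path
  ... | inj₁ (u≡last , v≡c) =
    spliced-trail P (gv A g1) Q path
      (subst (Port (gv C g4)) v≡c port-v) (subst (Port (gv A g1)) u≡last port-u) (λ ())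
      (from-yes (detours? P (gv A g1) Q)) refl
    where
      P Q : List GV
      P = through B ++ y ∷ through C
      Q = drop 1 (through A) ++ x ∷ through D ++ y ∷ []
  ... | inj₂ (u≡c , v≡last) =
    spliced-trail P (gv C g4) Q path
      (subst (Port (gv A g1)) u≡c port-u) (subst (Port (gv C g4)) v≡last port-v) (λ ())
      (from-yes (detours? P (gv C g4) Q)) refl
    where
      P Q : List GV
      P = through D ++ y ∷ reverse (through B) ++ x ∷ reverse (through A)
      Q = drop 1 (reverse (through C)) ++ y ∷ []

  vertices : List V′
  vertices = map inj₁ (allFin n) ++ map inj₂ gadgetVertices

  ∈-vertices : ∀ a → a ∈ vertices
  ∈-vertices (inj₁ b) = ∈-++⁺ˡ (∈-map⁺ inj₁ (∈-allFin b))
  ∈-vertices (inj₂ p) = ∈-++⁺ʳ (map inj₁ (allFin n)) (∈-map⁺ inj₂ (∈-gadgetVertices p))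

  length-vertices : length vertices ≡ n + 34
  length-vertices = trans (List.length-++ (map inj₁ (allFin n)))
                          (cong (_+ 34) (trans (List.length-map inj₁ (allFin n)) length-allFin))

  open Undirected (λ {a} {b} → adj′-sym {a} {b})

  module _ (cubic : Cubic G) where

    open Subcubic-trails (λ {a} → adj′-irrefl {a}) (subcubic cubic)

    trail-visits-all : ∀ {ws} → length ws ≡ suc (n + 34) → IsTrail (inj₂ x ∷ ws) → ∀ a → a ∈ inj₂ x ∷ ws
    trail-visits-all {w ∷ ws} len τ a =
      there (subst (a ∈_) (sym (init-last w ws))
        (∈-++⁺ˡ (Unique∧length≥⇒∈ _≟V′_ ∈-vertices interior long a)))
      where
        interior : Unique (init w ws)
        interior = interior-unique (inj₂ x) (init w ws) (last w ws)
                     (subst (λ l → IsTrail (inj₂ x ∷ l)) (init-last w ws) τ)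
        long : length vertices ≤ length (init w ws)
        long = ≤-reflexive (trans length-vertices (sym (trans (length-init w ws) (suc-injective len))))

    trail-cannot-end-in-G : ∀ {ws} α p c R → inj₂ x ∷ ws ≡ map inj₂ α ++ inj₂ p ∷ map inj₁ (c ∷ R) →
                            IsTrail (inj₂ x ∷ ws) → (∀ a → a ∈ inj₂ x ∷ ws) → ⊥
    trail-cannot-end-in-G {ws} α p c R shape τ visits =
      case trans (sym (port-used A-boundary (visits (inj₂ (gv A g1))) _))
                 (port-used C-boundary (visits (inj₂ (gv C g1))) _) of λ ()
      where
        ends-in-G : last (inj₂ x) ws ≡ inj₁ (last c R)
        ends-in-G = trans (last-≡++ (map inj₂ α) shape) (last-map inj₁ c R)
        crossing : ∀ {w q} → Uses (inj₂ x ∷ ws) (inj₁ w , inj₂ q) → p ≡ q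
        crossing (s , s∈ , s≈)
          with crossing-is-junction α p c R (subst (λ t → s ∈ steps t) shape s∈) (leftEnds-SameEdge s≈)
        ... | refl with s≈
        ...   | inj₂ (eq , _) = Sum.inj₂-injective eq
        port-used : ∀ {K e₁ w q} → Boundary (inCopy K) e₁ (inj₁ w , inj₂ q) →
                    ∀ {a} → a ∈ inj₂ x ∷ ws → T (inCopy K a) → p ≡ q
        port-used {K} boundary a∈ Ka =
          crossing (proj₂ (boundary-edges-used boundary (inj₂ x) ws τ (λ ()) outside a∈ Ka))
          where
            outside : ¬ T (inCopy K (last (inj₂ x) ws))
            outside = subst (λ z → ¬ T (inCopy K z)) (sym ends-in-G) (λ ())

    run-between-ports : ∀ p c R r R′ → IsTrail (inj₂ p ∷ map inj₁ (c ∷ R) ++ inj₂ r ∷ R′) →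
      Unique (c ∷ R) × All Edge (steps (map inj₁ (c ∷ R))) × SameEdge (u , v) (last c R , c) ×
      (∀ (b : Fin n) → inj₁ b ∉ inj₂ r ∷ R′)
    run-between-ports p c R r R′ τ@(trail (in-edge ∷ es) (in#S ∷ ds)) =
      Unique.map⁻ run-unique , All.++⁻ˡ _ es′ , ports-differ port-in port-out in#out , no-return
      where
        in-step out-step : V′ × V′
        in-step  = inj₂ p , inj₁ c
        out-step = inj₁ (last c R) , inj₂ r
        after : List (V′ × V′)
        after = steps (inj₂ r ∷ R′)
        split : steps (inj₁ c ∷ map inj₁ R ++ inj₂ r ∷ R′) ≡ steps (map inj₁ (c ∷ R)) ++ out-step ∷ after
        split = trans (steps-++ (inj₁ c) (map inj₁ R) (inj₂ r) R′)
                      (cong (λ e → steps (map inj₁ (c ∷ R)) ++ (e , inj₂ r) ∷ after) (last-map inj₁ c R))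
        es′ : All Edge (steps (map inj₁ (c ∷ R)) ++ out-step ∷ after)
        es′ = subst (All Edge) split es
        in# : All (Distinct in-step) (steps (map inj₁ (c ∷ R)) ++ out-step ∷ after)
        in# = subst (All (Distinct in-step)) split in#S
        out# : All (Distinct out-step) after
        out# with AllPairs-++⁻ (steps (map inj₁ (c ∷ R))) (subst (AllPairs Distinct) split ds)
        ... | _ , (out#after ∷ _) , _ = out#after
        in#out : Distinct in-step out-step
        in#out = All.lookup in# (∈-++⁺ʳ _ (here refl))
        port-in : Port p c
        port-in = port p in-edge
        port-out : Port r (last c R)
        port-out = port r (adj′-sym {inj₁ (last c R)} {inj₂ r} (All.lookup es′ (∈-++⁺ʳ _ (here refl))))
        run-unique : Unique (map inj₁ (c ∷ R))
        run-unique = interior-unique (inj₂ p) (map inj₁ (c ∷ R)) (inj₂ r)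
          (IsTrail-prefix (inj₂ p ∷ map inj₁ (c ∷ R) ++ inj₂ r ∷ [])
            (subst IsTrail (cong (inj₂ p ∷_) (sym (List.++-assoc (map inj₁ (c ∷ R)) (inj₂ r ∷ []) R′))) τ))
        -- a return to G would cross a third time, but both port edges are used already
        no-return : ∀ (b : Fin n) → inj₁ b ∉ inj₂ r ∷ R′
        no-return b (there b∈) with first-run-entry (first-run r R′ b∈)
        ... | cross∈
          with no-third-port port-in port-out (port _ (All.lookup es′ (∈-++⁺ʳ _ (there cross∈)))) in#out
        ...   | inj₁ same = All.lookup in# (∈-++⁺ʳ _ (there cross∈)) same
        ...   | inj₂ same = All.lookup out# cross∈ same

    run⇒path : ∀ {ws} α p c R r R′ → inj₂ x ∷ ws ≡ map inj₂ α ++ inj₂ p ∷ map inj₁ (c ∷ R) ++ inj₂ r ∷ R′ →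
                  IsTrail (inj₂ x ∷ ws) → (∀ a → a ∈ inj₂ x ∷ ws) → HamPath c R
    run⇒path α p c R r R′ shape τ visits
      with run-between-ports p c R r R′ (IsTrail-suffix (map inj₂ α) (subst IsTrail shape τ))
    ... | uniq , edges , closing , no-return = record
      { unique = uniq ; complete = complete ; edges = edges ; closing = closing }
      where
        complete : ∀ b → b ∈ c ∷ R
        complete b
          with ∈-left-run α p (c ∷ R) (inj₂ r ∷ R′) (subst (inj₁ {B = GV} b ∈_) shape (visits (inj₁ b)))
        ... | inj₁ b∈ = b∈
        ... | inj₂ b∈ = ⊥-elim (no-return b b∈)

    trail⇒path : TrailFrom adj′ (inj₂ x) (n + 34 + 1) → ∃₂ HamPath
    trail⇒path (ws , len , edges , distinct) = from-run (first-run x ws u∈ws)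
      where
        τ : IsTrail (inj₂ x ∷ ws)
        τ = trail (All.map (λ { {_ , _} e → e }) edges) distinct
        visits : ∀ a → a ∈ inj₂ x ∷ ws
        visits = trail-visits-all (trans len (+-comm (n + 34) 1)) τ
        u∈ws : inj₁ u ∈ ws
        u∈ws with visits (inj₁ u)
        ... | there u∈ = u∈
        from-run : FirstRun (inj₂ x ∷ ws) → ∃₂ HamPath
        from-run (run α p c R _ shape done) =
          ⊥-elim (trail-cannot-end-in-G α p c R
                   (trans shape (cong (λ l → map inj₂ α ++ inj₂ p ∷ l) (List.++-identityʳ _))) τ visits)
        from-run (run α p c R _ shape (leave r R′)) = c , R , run⇒path α p c R r R′ shape τ visits

    trail⇒cycle : TrailFrom adj′ (inj₂ x) (n + 34 + 1) → HamCycleThrough G u v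
    trail⇒cycle t with trail⇒path t
    ... | _ , _ , path = path⇒cycle cubic path

  cycle⇒trail : HamCycleThrough G u v → TrailFrom adj′ (inj₂ x) (n + 34 + 1)
  cycle⇒trail h with cycle⇒path h
  ... | _ , _ , path = path⇒trail path

-- Planarity and bipartiteness only keep G′ in the class of the reduction; the equivalence uses cubicity alone.
theorem5p3 : ∀ {n} (G : SimpleGraph n) → Planar G → Cubic G → Bipartite G →
    (u v : Fin n) → Adj (adj G) u v →
    HamCycleThrough G u v ⇔ TrailFrom (gadgetAdj G u v) (inj₂ x) (n + 34 + 1)
theorem5p3 G _ cubic _ u v uv = mk⇔ cycle⇒trail (trail⇒cycle cubic)
  where open Replacement G u v uv
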